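{- The total number of line shellings of the cube $\mathcal{C}_n=\{x\in\mathbb{R}^n:0\le x_i\le 1\}$ is $2^n (n!)^2$.
   Context: A line shelling of a $d$-polytope $\mathcal{P}\subset\mathbb{R}^d$: take a directed line $L$ meeting the interior of $\mathcal{P}$, parallel to no facet hyperplane and meeting no two facet hyperplanes in the same point, and a point $x\in L$ in the interior of $\mathcal{P}$; list the facets $F$ in the order in which $\mathrm{aff}(F)$ is met by a point starting at $x$, moving along $L$ in its direction to infinity and returning from infinity at the opposite end back to $x$ (this does not depend on the choice of $x$). The total number of line shellings is the number of distinct orderings so obtained over all such $L$.
   Formalization: The directed lines L are taken with base point x and direction vector in ℚ^n rather than ℝ^n. -}

module Defs where

open import Data.Nat using (ℕ)
open import Data.Fin using (Fin)
open import Data.Bool using (Bool; true; false)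
open import Data.Product using (_×_; _,_; Σ)
open import Data.Sum using (_⊎_)
open import Data.List using (List)
open import Data.List.Membership.Propositional using (_∈_)
open import Data.List.Relation.Unary.Unique.Propositional using (Unique)
open import Data.List.Relation.Unary.AllPairs using (AllPairs)
open import Data.Rational using (ℚ; 0ℚ; 1ℚ; _+_; _*_; _<_)
open import Relation.Binary.PropositionalEquality using (_≡_; _≢_)
open import Relation.Nullary using (¬_)

-- Facets of the cube C_n = [0,1]^n: the facet (i , b) lies in the
-- hyperplane x_i = 0 (b = false) or x_i = 1 (b = true).
Facet : ℕ → Set
Facet n = Fin n × Bool

bval : Bool → ℚ
bval false = 0ℚ
bval true  = 1ℚ

Pt : ℕ → Set
Pt n = Fin n → ℚ

Hits : {n : ℕ} → Pt n → Pt n → ℚ → Facet n → Set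
Hits p v t (i , b) = p i + t * v i ≡ bval b

-- Order in which parameter values are met when starting at t = 0,
-- moving to +∞, and returning from −∞ back to 0.
Before : ℚ → ℚ → Set
Before s t = (0ℚ < s × 0ℚ < t × s < t)
           ⊎ (0ℚ < s × t < 0ℚ)
           ⊎ (s < 0ℚ × t < 0ℚ × s < t)

record LineShellingVia (n : ℕ) (σ : List (Facet n)) : Set where
  field
    p v       : Pt n
    interior  : ∀ i → (0ℚ < p i) × (p i < 1ℚ)
    nonParallel : ∀ i → v i ≢ 0ℚ
    generic   : ∀ (F G : Facet n) → F ≢ G → ∀ t →
                Hits p v t F → ¬ Hits p v t G
    complete  : ∀ (F : Facet n) → F ∈ σ
    unique    : Unique σ
    ordered   : AllPairs (λ F G → ∀ s t → Hits p v s F → Hits p v t G → Before s t) σ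

IsLineShelling : (n : ℕ) → List (Facet n) → Set
IsLineShelling n σ = LineShellingVia n σ

-- Along a directed line through an interior point every coordinate moves monotonically, so
-- of the two facets x_i = 0 and x_i = 1 exactly one is met before the line passes through
-- infinity and the other one after.  A line shelling of the cube is therefore a choice of a
-- sign vector in {0,1}^n (which facet of each pair comes first), followed by the n outgoing
-- facets in some order and then the n returning facets in some order.  Conversely every such
-- list is a line shelling: the coordinates are independent, so the i-th coordinate of the line
-- can be chosen to meet its outgoing facet at any prescribed time a_i > 0 and its returning
-- facet at any prescribed time b_i < 0.
module Submission where

open import Defs
open import Algebra.Properties.Group using (∙-cancelʳ)
open import Data.Bool using (Bool; true; false; not) renaming (_≟_ to _≟ᵇ_)
open import Data.Bool.Properties using (¬-not; not-¬)
open import Data.Fin as Fin using (Fin)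
open import Data.List as List
  using (List; []; _∷_; _++_; [_]; map; concatMap; length; splitAt; cartesianProduct; cartesianProductWith)
open import Data.List.Properties
  using (length-++; length-map; length-tabulate; map-∘; map-id-local; ∷-injectiveˡ; ∷-injectiveʳ)
open import Data.List.Membership.Propositional using (_∈_; _∉_; find; lose)
open import Data.List.Membership.Propositional.Properties
  using (∈-map⁺; ∈-map⁻; ∈-++⁺ˡ; ∈-++⁺ʳ; ∈-++⁻; ∈-∃++; ∈-tabulate⁺; ∈-tabulate⁻;
         ∈-concatMap⁺; ∈-concatMap⁻; ∈-cartesianProductWith⁺; ∈-cartesianProduct⁺; ∈-cartesianProduct⁻)
open import Data.List.Relation.Unary.Any using (here; there)
open import Data.List.Relation.Unary.All as All using (All; []; _∷_)
import Data.List.Relation.Unary.All.Properties as Allₚ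
open import Data.List.Relation.Unary.AllPairs as AllPairs using (AllPairs; []; _∷_)
import Data.List.Relation.Unary.AllPairs.Properties as AllPairsₚ
open import Data.List.Relation.Unary.Unique.Propositional as Uniq using (Unique)
import Data.List.Relation.Unary.Unique.Propositional.Properties as Unique
open import Data.List.Relation.Binary.Subset.Propositional using (_⊆_)
open import Data.List.Relation.Binary.Permutation.Propositional
  using (_↭_; ↭-sym; ↭-trans; ↭-refl; prep; ↭⇒↭ₛ)
open import Data.List.Relation.Binary.Permutation.Propositional.Properties
  using (∈-resp-↭; ↭-length; ↭-empty-inv; shift; drop-mid)
import Data.List.Relation.Binary.Permutation.Setoid.Properties as Permutationₛ
open import Data.Nat as ℕ using (ℕ; zero; suc; _*_; _^_; _!; s≤s; z≤n)
import Data.Nat.Properties as ℕ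
open import Data.Product as Product using (Σ; ∃₂; _×_; _,_; proj₁; proj₂; uncurry)
open import Data.Product.Properties using (≡-dec)
open import Data.Rational
  using (ℚ; 0ℚ; 1ℚ; _<_; _+_; _-_; -_; 1/_; Positive; NonZero; positive; negative; ≢-nonZero)
  renaming (_*_ to _·_)
open import Data.Rational.Properties
  using (+-0-group; +-identityˡ; +-identityʳ; +-inverseʳ; +-monoˡ-<; +-monoʳ-<; *-assoc; *-identityʳ;
         *-inverseˡ; *-inverseʳ; *-zeroˡ; *-zeroʳ; *-monoˡ-<-pos; *-cancelʳ-≤-pos; *-cancelʳ-<-nonNeg;
         *-cancelʳ-<-nonPos; neg-antimono-<; neg-injective; <-cmp; <-irrefl; <-asym; <-trans; <⇒≢; _<?_;
         ≤-antisym; ≤-reflexive; positive⁻¹; pos⇒nonNeg; pos⇒nonZero; neg⇒nonPos; 1/pos⇒pos)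
open import Data.Rational.Solver using (module +-*-Solver)
open import Data.Sum as Sum using (_⊎_; inj₁; inj₂)
open import Data.Vec as Vec using (Vec; lookup; tabulate)
import Data.Vec.Properties as Vecₚ
open import Function using (_∘_; _∘′_; id)
open import Relation.Binary.Definitions using (DecidableEquality; Tri; tri<; tri≈; tri>)
open import Relation.Binary.PropositionalEquality
  using (_≡_; _≢_; refl; sym; trans; cong; cong₂; subst; subst₂; setoid; module ≡-Reasoning)
open import Relation.Nullary using (¬_; Dec; yes; no; contradiction)

open +-*-Solver using (solve; _:+_; _:*_; _:-_; :-_; _:=_; con)

private variable
  A B : Set

Unique-resp-↭ : ∀ {xs ys : List A} → xs ↭ ys → Unique xs → Unique ys
Unique-resp-↭ {A = A} p = Permutationₛ.Unique-resp-↭ (setoid A) (↭⇒↭ₛ p)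

Unique-++⁻ˡ : ∀ (xs : List A) {ys} → Unique (xs ++ ys) → Unique xs
Unique-++⁻ˡ []       _           = []
Unique-++⁻ˡ (x ∷ xs) (x∉ ∷ xys!) = Allₚ.++⁻ˡ xs x∉ ∷ Unique-++⁻ˡ xs xys!

Unique-++⁻ʳ : ∀ (xs : List A) {ys} → Unique (xs ++ ys) → Unique ys
Unique-++⁻ʳ []       ys!        = ys!
Unique-++⁻ʳ (x ∷ xs) (_ ∷ xys!) = Unique-++⁻ʳ xs xys!

Unique-concatMap⁺ : ∀ {f : A → List B} {xs} → Unique xs → (∀ {x} → x ∈ xs → Unique (f x)) →
                    (∀ {x y z} → x ∈ xs → y ∈ xs → z ∈ f x → z ∈ f y → x ≡ y) →
                    Unique (concatMap f xs)
Unique-concatMap⁺ {xs = []}               _          _      _      = []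
Unique-concatMap⁺ {f = f} {xs = x ∷ xs} (x∉ ∷ xs!) f-uniq f-disj =
  Unique.++⁺ (f-uniq (here refl))
             (Unique-concatMap⁺ xs! (f-uniq ∘′ there) λ x∈ y∈ → f-disj (there x∈) (there y∈))
             disjoint
  where
  disjoint : ∀ {z} → ¬ (z ∈ f x × z ∈ concatMap f xs)
  disjoint (z∈fx , z∈rest) with y , y∈xs , z∈fy ← find (∈-concatMap⁻ f z∈rest) =
    All.lookup x∉ y∈xs (f-disj (here refl) (there y∈xs) z∈fx z∈fy)

length-concatMap-const : ∀ (f : A → List B) xs {k} → All (λ x → length (f x) ≡ k) xs →
                         length (concatMap f xs) ≡ length xs * k
length-concatMap-const f []       []          = refl
length-concatMap-const f (x ∷ xs) (fx≡k ∷ fxs) =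
  trans (length-++ (f x)) (cong₂ ℕ._+_ fx≡k (length-concatMap-const f xs fxs))

length-cartesianProductWith : ∀ {C : Set} (f : A → B → C) xs ys →
                              length (cartesianProductWith f xs ys) ≡ length xs * length ys
length-cartesianProductWith f []       ys = refl
length-cartesianProductWith f (x ∷ xs) ys =
  trans (length-++ (map (f x) ys)) (cong₂ ℕ._+_ (length-map (f x) ys) (length-cartesianProductWith f xs ys))

splitAt-length-++ : ∀ (xs : List A) {ys} → splitAt (length xs) (xs ++ ys) ≡ (xs , ys)
splitAt-length-++ []       = refl
splitAt-length-++ (x ∷ xs) = cong (Product.map₁ (x ∷_)) (splitAt-length-++ xs)

Unique-map⁺-retraction : ∀ {f : A → B} (g : B → A) {xs} → All (λ x → g (f x) ≡ x) xs →
                         Unique xs → Unique (map f xs)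
Unique-map⁺-retraction g {xs} gf≡id xs! =
  Unique.map⁻ {f = g} (subst Unique (trans (sym (map-id-local gf≡id)) (map-∘ xs)) xs!)

span-AllPairs : ∀ {P : A → Set} {R : A → A → Set} → (∀ x → Dec (P x)) →
                (∀ {x y} → R x y → ¬ P x → ¬ P y) →
                ∀ {xs} → AllPairs R xs →
                ∃₂ λ ys zs → xs ≡ ys ++ zs × All P ys × All (¬_ ∘ P) zs
span-AllPairs P? closed {[]}     []         = [] , [] , refl , [] , []
span-AllPairs P? closed {x ∷ xs} (Rx ∷ Rxs) with P? x
... | no ¬Px = [] , x ∷ xs , refl , [] , ¬Px ∷ All.map (λ Rxy → closed Rxy ¬Px) Rx
... | yes Px with ys , zs , refl , Pys , ¬Pzs ← span-AllPairs P? closed Rxs =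
  x ∷ ys , zs , refl , Px ∷ Pys , ¬Pzs

Unique-⊆-⊇⇒↭ : ∀ {xs ys : List A} → Unique xs → Unique ys → xs ⊆ ys → ys ⊆ xs → xs ↭ ys
Unique-⊆-⊇⇒↭ {xs = []}     {[]}    _ _ _ _     = ↭-refl
Unique-⊆-⊇⇒↭ {xs = []}     {y ∷ _} _ _ _ ys⊆[] with () ← ys⊆[] (here refl)
Unique-⊆-⊇⇒↭ {xs = x ∷ xs} (x∉xs ∷ xs!) ys! xs⊆ys ys⊆xs
  with us , ws , refl ← ∈-∃++ (xs⊆ys (here refl)) =
  ↭-trans (prep x (Unique-⊆-⊇⇒↭ xs! (Uniq.tail x∷rest!) xs⊆rest rest⊆xs)) (↭-sym (shift x us ws))
  where
  x∷rest! : Unique (x ∷ us ++ ws)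
  x∷rest! = Unique-resp-↭ (shift x us ws) ys!
  xs⊆rest : xs ⊆ us ++ ws
  xs⊆rest y∈xs with ∈-resp-↭ (shift x us ws) (xs⊆ys (there y∈xs))
  ... | here refl    = contradiction refl (All.lookup x∉xs y∈xs)
  ... | there y∈rest = y∈rest
  rest⊆xs : us ++ ws ⊆ xs
  rest⊆xs y∈rest with ys⊆xs (∈-resp-↭ (↭-sym (shift x us ws)) (there y∈rest))
  ... | here refl  = contradiction refl (All.lookup (Uniq.head x∷rest!) y∈rest)
  ... | there y∈xs = y∈xs

AllPairs-map-within : ∀ {P : A → Set} {R S : A → A → Set} {xs} → All P xs →
                      (∀ {x y} → P x → P y → R x y → S x y) → AllPairs R xs → AllPairs S xs
AllPairs-map-within []         _ []         = []
AllPairs-map-within (Px ∷ Pxs) f (Rx ∷ Rxs) =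
  All.zipWith (λ (Py , Rxy) → f Px Py Rxy) (Pxs , Rx) ∷ AllPairs-map-within Pxs f Rxs

insertions : A → List A → List (List A)
insertions x []       = [ [ x ] ]
insertions x (y ∷ ys) = (x ∷ y ∷ ys) ∷ map (y ∷_) (insertions x ys)

permutations : List A → List (List A)
permutations []       = [ [] ]
permutations (x ∷ xs) = concatMap (insertions x) (permutations xs)

∈-insertions⁺ : ∀ (x : A) us ws → us ++ x ∷ ws ∈ insertions x (us ++ ws)
∈-insertions⁺ x []       []       = here refl
∈-insertions⁺ x []       (w ∷ ws) = here refl
∈-insertions⁺ x (u ∷ us) ws       = there (∈-map⁺ (u ∷_) (∈-insertions⁺ x us ws))

∈-insertions⁻ : ∀ (x : A) ys {zs} → zs ∈ insertions x ys →
                ∃₂ λ us ws → ys ≡ us ++ ws × zs ≡ us ++ x ∷ ws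
∈-insertions⁻ x []       (here refl) = [] , [] , refl , refl
∈-insertions⁻ x (y ∷ ys) (here refl) = [] , y ∷ ys , refl , refl
∈-insertions⁻ x (y ∷ ys) (there zs∈)
  with _ , zs′∈ , refl ← ∈-map⁻ (y ∷_) zs∈
  with us , ws , refl , refl ← ∈-insertions⁻ x ys zs′∈ = y ∷ us , ws , refl , refl

length-insertions : ∀ (x : A) ys → length (insertions x ys) ≡ suc (length ys)
length-insertions x []       = refl
length-insertions x (y ∷ ys) = cong suc (trans (length-map (y ∷_) (insertions x ys)) (length-insertions x ys))

cancel-insertion : ∀ {x : A} us ws us′ ws′ → x ∉ us → x ∉ us′ →
                   us ++ x ∷ ws ≡ us′ ++ x ∷ ws′ → us ++ ws ≡ us′ ++ ws′
cancel-insertion []       _  []         _   _    _     eq = ∷-injectiveʳ eq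
cancel-insertion []       _  (u′ ∷ us′) _   _    x∉us′ eq = contradiction (here (∷-injectiveˡ eq)) x∉us′
cancel-insertion (u ∷ us) _  []         _   x∉us _     eq = contradiction (here (sym (∷-injectiveˡ eq))) x∉us
cancel-insertion (u ∷ us) ws (u′ ∷ us′) ws′ x∉us x∉us′ eq =
  cong₂ _∷_ (∷-injectiveˡ eq)
            (cancel-insertion us ws us′ ws′ (x∉us ∘′ there) (x∉us′ ∘′ there) (∷-injectiveʳ eq))

insertions-disjoint : ∀ {x : A} ys ys′ {zs} → x ∉ ys → x ∉ ys′ →
                      zs ∈ insertions x ys → zs ∈ insertions x ys′ → ys ≡ ys′
insertions-disjoint {x = x} ys ys′ x∉ys x∉ys′ zs∈ zs∈′
  with us , ws , refl , refl ← ∈-insertions⁻ x ys zs∈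
  with us′ , ws′ , refl , eq ← ∈-insertions⁻ x ys′ zs∈′ =
  cancel-insertion us ws us′ ws′ (x∉ys ∘′ ∈-++⁺ˡ) (x∉ys′ ∘′ ∈-++⁺ˡ) eq

Unique-insertions : ∀ {x : A} ys → x ∉ ys → Unique (insertions x ys)
Unique-insertions []       _    = [] ∷ []
Unique-insertions (y ∷ ys) x∉ys =
  Allₚ.map⁺ (All.universal (λ _ eq → x∉ys (here (∷-injectiveˡ eq))) _)
  ∷ Unique.map⁺ ∷-injectiveʳ (Unique-insertions ys (x∉ys ∘′ there))

∈-permutations⁻ : ∀ (xs : List A) {zs} → zs ∈ permutations xs → zs ↭ xs
∈-permutations⁻ []       (here refl) = ↭-refl
∈-permutations⁻ (x ∷ xs) zs∈
  with ys , ys∈ , zs∈ins ← find (∈-concatMap⁻ (insertions x) zs∈)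
  with us , ws , refl , refl ← ∈-insertions⁻ x ys zs∈ins =
  ↭-trans (shift x us ws) (prep x (∈-permutations⁻ xs ys∈))

∈-permutations⁺ : ∀ (xs : List A) {zs} → zs ↭ xs → zs ∈ permutations xs
∈-permutations⁺ []       zs↭[] rewrite ↭-empty-inv zs↭[] = here refl
∈-permutations⁺ (x ∷ xs) zs↭
  with us , ws , refl ← ∈-∃++ (∈-resp-↭ (↭-sym zs↭) (here refl)) =
  ∈-concatMap⁺ (insertions x) (lose (∈-permutations⁺ xs (drop-mid us [] zs↭)) (∈-insertions⁺ x us ws))

length-permutations : ∀ (xs : List A) → length (permutations xs) ≡ length xs !
length-permutations []       = refl
length-permutations (x ∷ xs) = begin
  length (concatMap (insertions x) (permutations xs))
    ≡⟨ length-concatMap-const (insertions x) (permutations xs) (All.tabulate length-insertion) ⟩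
  length (permutations xs) * suc (length xs)
    ≡⟨ cong (_* suc (length xs)) (length-permutations xs) ⟩
  length xs ! * suc (length xs)
    ≡⟨ ℕ.*-comm (length xs !) (suc (length xs)) ⟩
  suc (length xs) ! ∎
  where
  open ≡-Reasoning
  length-insertion : ∀ {ys} → ys ∈ permutations xs → length (insertions x ys) ≡ suc (length xs)
  length-insertion {ys} ys∈ = trans (length-insertions x ys) (cong suc (↭-length (∈-permutations⁻ xs ys∈)))

Unique-permutations : ∀ {xs : List A} → Unique xs → Unique (permutations xs)
Unique-permutations {xs = []}     _            = [] ∷ []
Unique-permutations {xs = x ∷ xs} (x∉xs ∷ xs!) =
  Unique-concatMap⁺ (Unique-permutations xs!)
    (λ ys∈ → Unique-insertions _ (x∉ ys∈))
    (λ ys∈ ys′∈ → insertions-disjoint _ _ (x∉ ys∈) (x∉ ys′∈))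
  where
  x∉ : ∀ {ys} → ys ∈ permutations xs → x ∉ ys
  x∉ ys∈ x∈ys = All.lookup x∉xs (∈-resp-↭ (∈-permutations⁻ xs ys∈) x∈ys) refl

allVectors : List A → ∀ n → List (Vec A n)
allVectors xs zero    = [ Vec.[] ]
allVectors xs (suc n) = cartesianProductWith Vec._∷_ xs (allVectors xs n)

length-allVectors : ∀ (xs : List A) n → length (allVectors xs n) ≡ length xs ^ n
length-allVectors xs zero    = refl
length-allVectors xs (suc n) =
  trans (length-cartesianProductWith Vec._∷_ xs (allVectors xs n)) (cong (length xs *_) (length-allVectors xs n))

Unique-allVectors : ∀ {xs : List A} → Unique xs → ∀ n → Unique (allVectors xs n)
Unique-allVectors xs! zero    = [] ∷ []
Unique-allVectors xs! (suc n) = Unique.cartesianProductWith⁺ Vec._∷_ Vecₚ.∷-injective xs! (Unique-allVectors xs! n)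

∈-allVectors : ∀ {xs : List A} → (∀ x → x ∈ xs) → ∀ {n} (v : Vec A n) → v ∈ allVectors xs n
∈-allVectors _   Vec.[]      = here refl
∈-allVectors ∈xs (x Vec.∷ v) = ∈-cartesianProductWith⁺ Vec._∷_ (∈xs x) (∈-allVectors ∈xs v)

module _ (_≟_ : DecidableEquality A) where

  position : A → List A → ℕ
  position x []       = 0
  position x (y ∷ ys) with x ≟ y
  ... | yes _ = 0
  ... | no  _ = suc (position x ys)

  position-head : ∀ x xs → position x (x ∷ xs) ≡ 0
  position-head x xs with x ≟ x
  ... | yes _   = refl
  ... | no  x≢x = contradiction refl x≢x

  position-there : ∀ {x y} ys → y ≢ x → position x (y ∷ ys) ≡ suc (position x ys)
  position-there {x} {y} ys y≢x with x ≟ y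
  ... | yes refl = contradiction refl y≢x
  ... | no  _    = refl

  position-< : ∀ {x xs} → x ∈ xs → position x xs ℕ.< length xs
  position-< {x} {y ∷ ys} x∈ with x ≟ y | x∈
  ... | yes _   | _         = s≤s z≤n
  ... | no  x≢y | here x≡y  = contradiction x≡y x≢y
  ... | no  _   | there x∈′ = s≤s (position-< x∈′)

  position-injective : ∀ {x x′ xs} → x ∈ xs → x′ ∈ xs → position x xs ≡ position x′ xs → x ≡ x′
  position-injective {x} {x′} {y ∷ ys} x∈ x′∈ eq with x ≟ y | x′ ≟ y | x∈ | x′∈ | eq
  ... | yes refl | yes refl | _         | _          | _   = refl
  ... | no  x≢y  | _        | here x≡y  | _          | _   = contradiction x≡y x≢y
  ... | _        | no  x′≢y | _         | here x′≡y  | _   = contradiction x′≡y x′≢y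
  ... | no  _    | no  _    | there x∈′ | there x′∈′ | eq′ =
    position-injective x∈′ x′∈′ (ℕ.suc-injective eq′)

  position-increasing : ∀ {xs} → Unique xs → AllPairs (λ x y → position x xs ℕ.< position y xs) xs
  position-increasing {[]}     []           = []
  position-increasing {x ∷ xs} (x∉xs ∷ xs!) =
    All.map (λ x≢y → subst₂ ℕ._<_ (sym (position-head x xs)) (sym (position-there xs x≢y)) (s≤s z≤n)) x∉xs
    ∷ AllPairs-map-within x∉xs
        (λ x≢y x≢z lt → subst₂ ℕ._<_ (sym (position-there xs x≢y)) (sym (position-there xs x≢z)) (s≤s lt))
        (position-increasing xs!)

+-cancelʳ : ∀ {p q} r → p - r ≡ q - r → p ≡ q
+-cancelʳ {p} {q} r = ∙-cancelʳ +-0-group (- r) p q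

p<q⇒p-q<0 : ∀ {p q} → p < q → p - q < 0ℚ
p<q⇒p-q<0 {p} {q} p<q = subst (p - q <_) (+-inverseʳ q) (+-monoˡ-< (- q) p<q)

p<q⇒0<q-p : ∀ {p q} → p < q → 0ℚ < q - p
p<q⇒0<q-p {p} {q} p<q = subst (_< q - p) (+-inverseʳ p) (+-monoˡ-< (- p) p<q)

*-cancelʳ-≡-pos : ∀ {p q} r .{{_ : Positive r}} → p · r ≡ q · r → p ≡ q
*-cancelʳ-≡-pos r eq =
  ≤-antisym (*-cancelʳ-≤-pos r (≤-reflexive eq)) (*-cancelʳ-≤-pos r (≤-reflexive (sym eq)))

opposite-signs : ∀ {x y v} → 0ℚ < x · v → y · v < 0ℚ → (0ℚ < x × y < 0ℚ) ⊎ (x < 0ℚ × 0ℚ < y)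
opposite-signs {x} {y} {v} 0<xv yv<0 = by-sign (<-cmp v 0ℚ)
  where
  0v<xv : 0ℚ · v < x · v
  0v<xv = subst (_< x · v) (sym (*-zeroˡ v)) 0<xv
  yv<0v : y · v < 0ℚ · v
  yv<0v = subst (y · v <_) (sym (*-zeroˡ v)) yv<0
  by-sign : Tri (v < 0ℚ) (v ≡ 0ℚ) (0ℚ < v) → (0ℚ < x × y < 0ℚ) ⊎ (x < 0ℚ × 0ℚ < y)
  by-sign (tri< v<0 _ _) = inj₂ (*-cancelʳ-<-nonPos v 0v<xv , *-cancelʳ-<-nonPos v yv<0v)
    where instance _ = neg⇒nonPos v {{negative v<0}}
  by-sign (tri≈ _ v≡0 _) = contradiction (subst (0ℚ <_) (trans (cong (x ·_) v≡0) (*-zeroʳ x)) 0<xv) (<-irrefl refl)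
  by-sign (tri> _ _ 0<v) = inj₁ (*-cancelʳ-<-nonNeg v 0v<xv , *-cancelʳ-<-nonNeg v yv<0v)
    where instance _ = pos⇒nonNeg v {{positive 0<v}}

fromℕ : ℕ → ℚ
fromℕ zero    = 0ℚ
fromℕ (suc n) = 1ℚ + fromℕ n

p<1+p : ∀ p → p < 1ℚ + p
p<1+p p = subst (_< 1ℚ + p) (+-identityˡ p) (+-monoˡ-< p (positive⁻¹ 1ℚ))

fromℕ-mono-< : ∀ {m n} → m ℕ.< n → fromℕ m < fromℕ n
fromℕ-mono-< {m} {suc n} (s≤s m≤n) with ℕ.m≤n⇒m<n∨m≡n m≤n
... | inj₁ m<n  = <-trans (fromℕ-mono-< m<n) (p<1+p (fromℕ n))
... | inj₂ refl = p<1+p (fromℕ n)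

fromℕ-injective : ∀ {m n} → fromℕ m ≡ fromℕ n → m ≡ n
fromℕ-injective {m} {n} eq with ℕ.<-cmp m n
... | tri< m<n _ _ = contradiction eq (<⇒≢ (fromℕ-mono-< m<n))
... | tri≈ _ m≡n _ = m≡n
... | tri> _ _ n<m = contradiction (sym eq) (<⇒≢ (fromℕ-mono-< n<m))

0<fromℕ-suc : ∀ n → 0ℚ < fromℕ (suc n)
0<fromℕ-suc n = fromℕ-mono-< {0} {suc n} (s≤s z≤n)

record SegmentCrossing (a b : ℚ) (β : Bool) : Set where
  field
    p v        : ℚ
    interior   : 0ℚ < p × p < 1ℚ
    moving     : v ≢ 0ℚ
    reaches-β  : ∀ t → p + t · v ≡ bval β → t ≡ a
    reaches-¬β : ∀ t → p + t · v ≡ bval (not β) → t ≡ b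

-- The line t ↦ (t − b) / (a − b).
ascendingCrossing : ∀ {a b} → b < 0ℚ → 0ℚ < a → SegmentCrossing a b true
ascendingCrossing {a} {b} b<0 0<a = record
  { p          = - b · w
  ; v          = w
  ; interior   = subst (_< - b · w) (*-zeroˡ w) (*-monoˡ-<-pos w (neg-antimono-< b<0))
               , subst (- b · w <_) (*-inverseʳ d) (*-monoˡ-<-pos w -b<a-b)
  ; moving     = λ w≡0 → <-irrefl (sym w≡0) (positive⁻¹ w)
  ; reaches-β  = λ t hit → +-cancelʳ b (*-cancelʳ-≡-pos w (begin
      (t - b) · w ≡⟨ value t ⟨
      - b · w + t · w ≡⟨ hit ⟩
      1ℚ ≡⟨ *-inverseʳ d ⟨
      d · w ∎))
  ; reaches-¬β = λ t hit → +-cancelʳ b (*-cancelʳ-≡-pos w (begin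
      (t - b) · w ≡⟨ value t ⟨
      - b · w + t · w ≡⟨ hit ⟩
      0ℚ ≡⟨ *-zeroˡ w ⟨
      0ℚ · w ≡⟨ cong (_· w) (+-inverseʳ b) ⟨
      (b - b) · w ∎))
  }
  where
  open ≡-Reasoning
  d : ℚ
  d = a - b
  -b<a-b : - b < a - b
  -b<a-b = subst (_< a - b) (+-identityˡ (- b)) (+-monoˡ-< (- b) 0<a)
  instance
    d-positive : Positive d
    d-positive = positive (p<q⇒0<q-p (<-trans b<0 0<a))
    d-nonZero : NonZero d
    d-nonZero = pos⇒nonZero d
  w : ℚ
  w = 1/ d
  instance
    w-positive : Positive w
    w-positive = 1/pos⇒pos d
  value : ∀ t → - b · w + t · w ≡ (t - b) · w
  value t = solve 3 (λ b t w → (:- b) :* w :+ t :* w := (t :- b) :* w) refl b t w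

1-bval : ∀ β → 1ℚ - bval β ≡ bval (not β)
1-bval true  = +-inverseʳ 1ℚ
1-bval false = +-identityʳ 1ℚ

-- The reflection x ↦ 1 − x of the segment exchanges its endpoints.
reflectCrossing : ∀ {a b β} → SegmentCrossing a b β → SegmentCrossing a b (not β)
reflectCrossing {a} {b} {β} c = record
  { p          = 1ℚ - p
  ; v          = - v
  ; interior   = p<q⇒0<q-p (proj₂ interior)
               , subst (1ℚ - p <_) (+-identityʳ 1ℚ) (+-monoʳ-< 1ℚ (neg-antimono-< (proj₁ interior)))
  ; moving     = moving ∘ neg-injective
  ; reaches-β  = λ t hit → reaches-β t (mirror t (trans hit (sym (1-bval β))))
  ; reaches-¬β = λ t hit → reaches-¬β t (mirror t (trans hit (sym (1-bval (not β)))))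
  }
  where
  open SegmentCrossing c
  mirror : ∀ t {x} → (1ℚ - p) + t · - v ≡ 1ℚ - x → p + t · v ≡ x
  mirror t {x} eq = begin
    p + t · v
      ≡⟨ solve 3 (λ p t v → p :+ t :* v := con 1ℚ :- ((con 1ℚ :- p) :+ t :* (:- v))) refl p t v ⟩
    1ℚ - ((1ℚ - p) + t · - v) ≡⟨ cong (λ y → 1ℚ - y) eq ⟩
    1ℚ - (1ℚ - x)             ≡⟨ solve 1 (λ x → con 1ℚ :- (con 1ℚ :- x) := x) refl x ⟩
    x                         ∎
    where open ≡-Reasoning

segmentCrossing : ∀ {a b} → b < 0ℚ → 0ℚ < a → ∀ β → SegmentCrossing a b β
segmentCrossing b<0 0<a true  = ascendingCrossing b<0 0<a
segmentCrossing b<0 0<a false = reflectCrossing (ascendingCrossing b<0 0<a)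

_≟ᶠ_ : ∀ {n} → DecidableEquality (Facet n)
_≟ᶠ_ = ≡-dec Fin._≟_ _≟ᵇ_

graph : ∀ {n} {B : Set} → (Fin n → B) → List (Fin n × B)
graph f = List.tabulate (λ i → i , f i)

length-graph : ∀ {n} {B : Set} (f : Fin n → B) → length (graph f) ≡ n
length-graph f = length-tabulate _

module _ {n} {B : Set} {f : Fin n → B} where

  ∈-graph⁺ : ∀ i → (i , f i) ∈ graph f
  ∈-graph⁺ = ∈-tabulate⁺

  ∈-graph⁻ : ∀ {i b} → (i , b) ∈ graph f → b ≡ f i
  ∈-graph⁻ ib∈ with _ , refl ← ∈-tabulate⁻ ib∈ = refl

  Unique-graph : Unique (graph f)
  Unique-graph = Unique.tabulate⁺ (cong proj₁)

  ↭-graph : ∀ {xs} → Unique xs → All (λ (i , b) → b ≡ f i) xs → (∀ i → (i , f i) ∈ xs) →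
            xs ↭ graph f
  ↭-graph xs! on-graph covers = Unique-⊆-⊇⇒↭ xs! Unique-graph
    (λ {(i , b)} ib∈ → subst (λ b → (i , b) ∈ graph f) (sym (All.lookup on-graph ib∈)) (∈-graph⁺ i))
    (λ ib∈ → let i , eq = ∈-tabulate⁻ ib∈ in subst (_∈ _) (sym eq) (covers i))

graph-↭-injective : ∀ {n} {B : Set} {f g : Fin n → B} → graph f ↭ graph g → ∀ i → f i ≡ g i
graph-↭-injective {f = f} f↭g i = ∈-graph⁻ (∈-resp-↭ f↭g (∈-graph⁺ {f = f} i))

graph-dichotomy : ∀ {n} (f : Fin n → Bool) F → F ∈ graph f ⊎ F ∈ graph (not ∘ f)
graph-dichotomy f (i , b) with b ≟ᵇ f i
... | yes refl = inj₁ (∈-graph⁺ i)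
... | no  b≢fi = inj₂ (subst (λ c → (i , c) ∈ graph (not ∘ f)) (sym (¬-not b≢fi)) (∈-graph⁺ i))

record OutAndBack (n : ℕ) (σ : List (Facet n)) : Set where
  field
    signs    : Vec Bool n
    out back : List (Facet n)
    split    : σ ≡ out ++ back
    out↭     : out ↭ graph (lookup signs)
    back↭    : back ↭ graph (not ∘ lookup signs)

-- Every out-and-back list is a line shelling

module Realisation {n σ} (ob : OutAndBack n σ) where
  open OutAndBack ob

  s : Fin n → Bool
  s = lookup signs

  outTime backTime : Facet n → ℚ
  outTime  F = fromℕ (suc (position _≟ᶠ_ F out))
  backTime F = fromℕ (position _≟ᶠ_ F back) - fromℕ n

  0<outTime : ∀ F → 0ℚ < outTime F
  0<outTime F = 0<fromℕ-suc (position _≟ᶠ_ F out)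

  backTime<0 : ∀ {F} → F ∈ back → backTime F < 0ℚ
  backTime<0 {F} F∈ = p<q⇒p-q<0 (fromℕ-mono-< (subst (position _≟ᶠ_ F back ℕ.<_)
    (trans (↭-length back↭) (length-graph (not ∘ s))) (position-< _≟ᶠ_ F∈)))

  crossing : ∀ i → SegmentCrossing (outTime (i , s i)) (backTime (i , not (s i))) (s i)
  crossing i = segmentCrossing (backTime<0 (∈-resp-↭ (↭-sym back↭) (∈-graph⁺ i))) (0<outTime _) (s i)

  p v : Pt n
  p i = SegmentCrossing.p (crossing i)
  v i = SegmentCrossing.v (crossing i)

  out-or-back : ∀ F → F ∈ out ⊎ F ∈ back
  out-or-back F = Sum.map (∈-resp-↭ (↭-sym out↭)) (∈-resp-↭ (↭-sym back↭)) (graph-dichotomy s F)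

  hits-out : ∀ {F} t → F ∈ out → Hits p v t F → t ≡ outTime F
  hits-out {i , b} t F∈ hit with refl ← ∈-graph⁻ (∈-resp-↭ out↭ F∈) =
    SegmentCrossing.reaches-β (crossing i) t hit

  hits-back : ∀ {F} t → F ∈ back → Hits p v t F → t ≡ backTime F
  hits-back {i , b} t F∈ hit with refl ← ∈-graph⁻ (∈-resp-↭ back↭ F∈) =
    SegmentCrossing.reaches-¬β (crossing i) t hit

  outTime≢backTime : ∀ {F G} → G ∈ back → outTime F ≢ backTime G
  outTime≢backTime {F} G∈ eq = <-asym (0<outTime F) (subst (_< 0ℚ) (sym eq) (backTime<0 G∈))

  generic : ∀ F G → F ≢ G → ∀ t → Hits p v t F → ¬ Hits p v t G
  generic F G F≢G t hitF hitG with out-or-back F | out-or-back G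
  ... | inj₁ F∈ | inj₁ G∈ = F≢G (position-injective _≟ᶠ_ F∈ G∈
          (ℕ.suc-injective (fromℕ-injective (trans (sym (hits-out t F∈ hitF)) (hits-out t G∈ hitG)))))
  ... | inj₁ F∈ | inj₂ G∈ = outTime≢backTime G∈ (trans (sym (hits-out t F∈ hitF)) (hits-back t G∈ hitG))
  ... | inj₂ F∈ | inj₁ G∈ = outTime≢backTime F∈ (trans (sym (hits-out t G∈ hitG)) (hits-back t F∈ hitF))
  ... | inj₂ F∈ | inj₂ G∈ = F≢G (position-injective _≟ᶠ_ F∈ G∈
          (fromℕ-injective (+-cancelʳ (fromℕ n) (trans (sym (hits-back t F∈ hitF)) (hits-back t G∈ hitG)))))

  MetBefore : Facet n → Facet n → Set
  MetBefore F G = ∀ t u → Hits p v t F → Hits p v u G → Before t u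

  out-ordered : ∀ {F G} → F ∈ out → G ∈ out →
                position _≟ᶠ_ F out ℕ.< position _≟ᶠ_ G out → MetBefore F G
  out-ordered {F} {G} F∈ G∈ lt t u hitF hitG
    with refl ← hits-out t F∈ hitF | refl ← hits-out u G∈ hitG =
    inj₁ (0<outTime F , 0<outTime G , fromℕ-mono-< (s≤s lt))

  back-ordered : ∀ {F G} → F ∈ back → G ∈ back →
                 position _≟ᶠ_ F back ℕ.< position _≟ᶠ_ G back → MetBefore F G
  back-ordered {F} {G} F∈ G∈ lt t u hitF hitG
    with refl ← hits-back t F∈ hitF | refl ← hits-back u G∈ hitG =
    inj₂ (inj₂ (backTime<0 F∈ , backTime<0 G∈ , +-monoˡ-< (- fromℕ n) (fromℕ-mono-< lt)))

  out-before-back : ∀ {F G} → F ∈ out → G ∈ back → MetBefore F G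
  out-before-back {F} {G} F∈ G∈ t u hitF hitG
    with refl ← hits-out t F∈ hitF | refl ← hits-back u G∈ hitG =
    inj₂ (inj₁ (0<outTime F , backTime<0 G∈))

  out! : Unique out
  out! = Unique-resp-↭ (↭-sym out↭) Unique-graph

  back! : Unique back
  back! = Unique-resp-↭ (↭-sym back↭) Unique-graph

  out-back-disjoint : ∀ {F} → ¬ (F ∈ out × F ∈ back)
  out-back-disjoint {i , b} (F∈out , F∈back) =
    not-¬ (∈-graph⁻ (∈-resp-↭ out↭ F∈out)) (∈-graph⁻ (∈-resp-↭ back↭ F∈back))

  isLineShelling : IsLineShelling n σ
  isLineShelling = record
    { p           = p
    ; v           = v
    ; interior    = SegmentCrossing.interior ∘ crossing
    ; nonParallel = SegmentCrossing.moving ∘ crossing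
    ; generic     = generic
    ; complete    = λ F → subst (F ∈_) (sym split) (Sum.[ ∈-++⁺ˡ , ∈-++⁺ʳ out ]′ (out-or-back F))
    ; unique      = subst Unique (sym split) (Unique.++⁺ out! back! out-back-disjoint)
    ; ordered     = subst (AllPairs MetBefore) (sym split) (AllPairsₚ.++⁺
        (AllPairs-map-within (All.tabulate id) out-ordered (position-increasing _≟ᶠ_ out!))
        (AllPairs-map-within (All.tabulate id) back-ordered (position-increasing _≟ᶠ_ back!))
        (All.tabulate λ F∈ → All.tabulate λ G∈ → out-before-back F∈ G∈))
    }

-- Every line shelling is an out-and-back list

Before-nonpositive : ∀ {s t} → Before s t → ¬ 0ℚ < s → ¬ 0ℚ < t
Before-nonpositive (inj₁ (0<s , _))            0≮s = contradiction 0<s 0≮s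
Before-nonpositive (inj₂ (inj₁ (0<s , _)))     0≮s = contradiction 0<s 0≮s
Before-nonpositive (inj₂ (inj₂ (_ , t<0 , _))) _   = <-asym t<0

module Decomposition {n σ} (shelling : IsLineShelling n σ) where
  open LineShellingVia shelling

  instance
    v-nonZero : ∀ {i} → NonZero (v i)
    v-nonZero {i} = ≢-nonZero (nonParallel i)

  -- Opaque, so that a constraint `time ?F = time F` is solved by ?F := F instead of
  -- unfolding rational arithmetic.
  opaque
    time : Facet n → ℚ
    time (i , b) = (bval b - p i) · 1/ v i

    time-scaled : ∀ i b → time (i , b) · v i ≡ bval b - p i
    time-scaled i b = begin
      (bval b - p i) · 1/ v i · v i   ≡⟨ *-assoc (bval b - p i) (1/ v i) (v i) ⟩
      (bval b - p i) · (1/ v i · v i) ≡⟨ cong ((bval b - p i) ·_) (*-inverseˡ (v i)) ⟩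
      (bval b - p i) · 1ℚ             ≡⟨ *-identityʳ (bval b - p i) ⟩
      bval b - p i                    ∎
      where open ≡-Reasoning

    hits-time : ∀ F → Hits p v (time F) F
    hits-time (i , b) =
      trans (cong (p i +_) (time-scaled i b)) (solve 2 (λ p b → p :+ (b :- p) := b) refl (p i) (bval b))

  orientation : ∀ i → Σ Bool λ b → 0ℚ < time (i , b) × time (i , not b) < 0ℚ
  orientation i
    with opposite-signs (subst (0ℚ <_) (sym (time-scaled i true)) (p<q⇒0<q-p (proj₂ (interior i))))
                        (subst (_< 0ℚ) (sym (time-scaled i false)) (p<q⇒p-q<0 (proj₁ (interior i))))
  ... | inj₁ (0<t , f<0) = true  , 0<t , f<0
  ... | inj₂ (t<0 , 0<f) = false , 0<f , t<0

  signs : Vec Bool n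
  signs = tabulate (proj₁ ∘ orientation)

  forward : ∀ i → 0ℚ < time (i , lookup signs i)
  forward i rewrite Vecₚ.lookup∘tabulate (proj₁ ∘ orientation) i = proj₁ (proj₂ (orientation i))

  backward : ∀ i → time (i , not (lookup signs i)) < 0ℚ
  backward i rewrite Vecₚ.lookup∘tabulate (proj₁ ∘ orientation) i = proj₂ (proj₂ (orientation i))

  forward-sign : ∀ {i b} → 0ℚ < time (i , b) → b ≡ lookup signs i
  forward-sign {i} {b} 0<t with b ≟ᵇ lookup signs i
  ... | yes b≡s = b≡s
  ... | no  b≢s = contradiction 0<t (<-asym (subst (λ c → time (i , c) < 0ℚ) (sym (¬-not b≢s)) (backward i)))

  backward-sign : ∀ {i b} → ¬ 0ℚ < time (i , b) → b ≡ not (lookup signs i)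
  backward-sign {i} {b} 0≮t with b ≟ᵇ lookup signs i
  ... | yes refl = contradiction (forward i) 0≮t
  ... | no  b≢s  = ¬-not b≢s

  before-times : AllPairs (λ F G → Before (time F) (time G)) σ
  before-times = AllPairs.map (λ {F} {G} met → met (time F) (time G) (hits-time F) (hits-time G)) ordered

  outAndBack : OutAndBack n σ
  outAndBack
    with out , back , refl , outs , backs ← span-AllPairs (λ F → 0ℚ <? time F) Before-nonpositive before-times =
    record
      { signs = signs
      ; out   = out
      ; back  = back
      ; split = refl
      ; out↭  = ↭-graph (Unique-++⁻ˡ out unique) (All.map forward-sign outs) covers-out
      ; back↭ = ↭-graph (Unique-++⁻ʳ out unique) (All.map backward-sign backs) covers-back
      }
    where
    covers-out : ∀ i → (i , lookup signs i) ∈ out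
    covers-out i with ∈-++⁻ out (complete (i , lookup signs i))
    ... | inj₁ ∈out  = ∈out
    ... | inj₂ ∈back = contradiction (forward i) (All.lookup backs ∈back)
    covers-back : ∀ i → (i , not (lookup signs i)) ∈ back
    covers-back i with ∈-++⁻ out (complete (i , not (lookup signs i)))
    ... | inj₁ ∈out  = contradiction (All.lookup outs ∈out) (<-asym (backward i))
    ... | inj₂ ∈back = ∈back

-- Enumeration

signVectors : ∀ n → List (Vec Bool n)
signVectors = allVectors (true ∷ false ∷ [])

∈-signVectors : ∀ {n} (s : Vec Bool n) → s ∈ signVectors n
∈-signVectors = ∈-allVectors λ where
  true  → here refl
  false → there (here refl)

Unique-signVectors : ∀ n → Unique (signVectors n)
Unique-signVectors = Unique-allVectors (((λ ()) ∷ []) ∷ [] ∷ [])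

splittings : ∀ {n} → Vec Bool n → List (List (Facet n) × List (Facet n))
splittings s = cartesianProduct (permutations (graph (lookup s))) (permutations (graph (not ∘ lookup s)))

allSplittings : ∀ n → List (List (Facet n) × List (Facet n))
allSplittings n = concatMap splittings (signVectors n)

lineShellings : ∀ n → List (List (Facet n))
lineShellings n = map (uncurry _++_) (allSplittings n)

module _ {n} {s : Vec Bool n} where

  ∈-splittings⁺ : ∀ {out back} → out ↭ graph (lookup s) → back ↭ graph (not ∘ lookup s) →
                  (out , back) ∈ splittings s
  ∈-splittings⁺ out↭ back↭ = ∈-cartesianProduct⁺ (∈-permutations⁺ _ out↭) (∈-permutations⁺ _ back↭)

  ∈-splittings⁻ : ∀ {out back} → (out , back) ∈ splittings s →
                  out ↭ graph (lookup s) × back ↭ graph (not ∘ lookup s)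
  ∈-splittings⁻ ob∈ with out∈ , back∈ ← ∈-cartesianProduct⁻ _ _ ob∈ =
    ∈-permutations⁻ _ out∈ , ∈-permutations⁻ _ back∈

  Unique-splittings : Unique (splittings s)
  Unique-splittings = Unique.cartesianProduct⁺ (Unique-permutations Unique-graph) (Unique-permutations Unique-graph)

  length-splittings : length (splittings s) ≡ n ! * n !
  length-splittings = begin
    length (splittings s)
      ≡⟨ length-cartesianProductWith _,_ (permutations (graph (lookup s))) _ ⟩
    length (permutations (graph (lookup s))) * length (permutations (graph (not ∘ lookup s)))
      ≡⟨ cong₂ _*_ (length-permutations (graph (lookup s))) (length-permutations (graph (not ∘ lookup s))) ⟩
    length (graph (lookup s)) ! * length (graph (not ∘ lookup s)) !
      ≡⟨ cong₂ (λ k l → k ! * l !) (length-graph (lookup s)) (length-graph (not ∘ lookup s)) ⟩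
    n ! * n ! ∎
    where open ≡-Reasoning

∈-allSplittings⁻ : ∀ {n out back} → (out , back) ∈ allSplittings n →
                   Σ (Vec Bool n) λ s → out ↭ graph (lookup s) × back ↭ graph (not ∘ lookup s)
∈-allSplittings⁻ {n} ob∈ with s , _ , ob∈s ← find (∈-concatMap⁻ splittings {xs = signVectors n} ob∈) =
  s , ∈-splittings⁻ {s = s} ob∈s

∈-lineShellings⁺ : ∀ {n σ} → OutAndBack n σ → σ ∈ lineShellings n
∈-lineShellings⁺ {n} ob = subst (_∈ lineShellings n) (sym split) (∈-map⁺ (uncurry _++_)
  (∈-concatMap⁺ splittings (lose (∈-signVectors signs) (∈-splittings⁺ {s = signs} out↭ back↭))))
  where open OutAndBack ob

∈-lineShellings⁻ : ∀ {n σ} → σ ∈ lineShellings n → OutAndBack n σ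
∈-lineShellings⁻ σ∈
  with (out , back) , ob∈ , refl ← ∈-map⁻ (uncurry _++_) σ∈
  with s , out↭ , back↭ ← ∈-allSplittings⁻ ob∈ =
  record { signs = s ; out = out ; back = back ; split = refl ; out↭ = out↭ ; back↭ = back↭ }

Unique-lineShellings : ∀ n → Unique (lineShellings n)
Unique-lineShellings n =
  Unique-map⁺-retraction (splitAt n) (All.tabulate splitAt-retracts)
    (Unique-concatMap⁺ (Unique-signVectors n) (λ {s} _ → Unique-splittings {s = s}) same-signs)
  where
  splitAt-retracts : ∀ {ob} → ob ∈ allSplittings n → splitAt n (uncurry _++_ ob) ≡ ob
  splitAt-retracts {out , back} ob∈ with s , out↭ , _ ← ∈-allSplittings⁻ ob∈ =
    subst (λ k → splitAt k (out ++ back) ≡ (out , back))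
          (trans (↭-length out↭) (length-graph (lookup s)))
          (splitAt-length-++ out)
  same-signs : ∀ {s s′ ob} → s ∈ signVectors n → s′ ∈ signVectors n →
               ob ∈ splittings s → ob ∈ splittings s′ → s ≡ s′
  same-signs {s} {s′} _ _ ob∈s ob∈s′ = begin
    s                       ≡⟨ Vecₚ.tabulate∘lookup s ⟨
    tabulate (lookup s)     ≡⟨ Vecₚ.tabulate-cong (graph-↭-injective (↭-trans (↭-sym out↭) out↭′)) ⟩
    tabulate (lookup s′)    ≡⟨ Vecₚ.tabulate∘lookup s′ ⟩
    s′                      ∎
    where
    open ≡-Reasoning
    out↭  = proj₁ (∈-splittings⁻ {s = s} ob∈s)
    out↭′ = proj₁ (∈-splittings⁻ {s = s′} ob∈s′)

length-lineShellings : ∀ n → length (lineShellings n) ≡ 2 ^ n * n ! * n !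
length-lineShellings n = begin
  length (lineShellings n)
    ≡⟨ length-map (uncurry _++_) (allSplittings n) ⟩
  length (allSplittings n)
    ≡⟨ length-concatMap-const splittings (signVectors n) (All.universal (λ s → length-splittings {s = s}) _) ⟩
  length (signVectors n) * (n ! * n !)
    ≡⟨ cong (_* (n ! * n !)) (length-allVectors (true ∷ false ∷ []) n) ⟩
  2 ^ n * (n ! * n !)
    ≡⟨ ℕ.*-assoc (2 ^ n) (n !) (n !) ⟨
  2 ^ n * n ! * n ! ∎
  where open ≡-Reasoning

mainTheorem4 : (n : ℕ) →
    Σ (List (List (Facet n))) (λ shellings →
      Unique shellings
      × length shellings ≡ 2 ^ n * (n !) * (n !)
      × (∀ (σ : List (Facet n)) →
           (σ ∈ shellings → IsLineShelling n σ)
           × (IsLineShelling n σ → σ ∈ shellings)))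
mainTheorem4 n =
  lineShellings n , Unique-lineShellings n , length-lineShellings n ,
  λ σ → Realisation.isLineShelling ∘ ∈-lineShellings⁻ , ∈-lineShellings⁺ ∘ Decomposition.outAndBack
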